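{- Let $\Gamma\curvearrowright X, I$ be a dynamical ideal. If the dynamical ideal has cofinal orbits, then Player II has a winning strategy in the DC game.
   Context: A dynamical ideal $\Gamma\curvearrowright X, I$ consists of a group $\Gamma$ acting on a set $X$ and an ideal $I$ on $X$ containing all singletons and invariant under the action ($\gamma\cdot a=\{\gamma\cdot x\colon x\in a\}\in I$ for $a\in I$). For $a\subseteq X$, $\mathrm{pstab}(a)=\{\gamma\in\Gamma\colon\forall x\in a\ \gamma\cdot x=x\}$. The dynamical ideal has cofinal orbits if for every $a\in I$ there is $b\in I$ which is $a$-large: for every $c\in I$ there is $\gamma\in\mathrm{pstab}(a)$ with $c\subseteq\gamma\cdot b$. The DC game: Players I and II alternate for $\omega$ rounds; at round $n$ Player I plays a set $a_n\in I$ and Player II answers with $\gamma_n\in\Gamma$, subject to the rules that $\gamma_0=1$ and each $\gamma_n$ fixes every element of $\bigcup_{m<n}\gamma_m\cdot a_m$. Player II wins if $\bigcup_{n\in\omega}\gamma_n\cdot a_n\in I$. -}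

module Defs where

open import Level using (0ℓ)
open import Algebra.Bundles using (Group)
open import Data.Nat using (ℕ; _<_)
open import Data.Fin using (Fin; toℕ)
open import Data.Product using (Σ; ∃; ∃-syntax; _×_)
open import Relation.Binary.PropositionalEquality using (_≡_)
open import Relation.Unary using (Pred; _⊆_; _∪_; _∈_; ｛_｝)

record IsAction (Γ : Group 0ℓ 0ℓ) (X : Set) (act : Group.Carrier Γ → X → X) : Set where
  open Group Γ
  field
    act-cong : ∀ {g h} → g ≈ h → ∀ x → act g x ≡ act h x
    act-id   : ∀ x → act ε x ≡ x
    act-comp : ∀ g h x → act (g ∙ h) x ≡ act g (act h x)

-- An ideal on X: closed under subsets and finite unions (contains ∅ via singletons + subsets).
record IsIdeal {X : Set} (I : Pred (Pred X 0ℓ) 0ℓ) : Set₁ where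
  field
    downward  : ∀ {a b : Pred X 0ℓ} → a ⊆ b → b ∈ I → a ∈ I
    union     : ∀ {a b : Pred X 0ℓ} → a ∈ I → b ∈ I → (a ∪ b) ∈ I

image : {G X : Set} → (G → X → X) → G → Pred X 0ℓ → Pred X 0ℓ
image act γ a y = ∃[ x ] (a x × act γ x ≡ y)

record IsDynamicalIdeal (Γ : Group 0ℓ 0ℓ) (X : Set)
       (act : Group.Carrier Γ → X → X) (I : Pred (Pred X 0ℓ) 0ℓ) : Set₁ where
  field
    isAction   : IsAction Γ X act
    isIdeal    : IsIdeal I
    singletons : ∀ x → ｛ x ｝ ∈ I
    invariant  : ∀ γ {a} → a ∈ I → image act γ a ∈ I

pstab : {G X : Set} → (G → X → X) → Pred X 0ℓ → Pred G 0ℓ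
pstab act a γ = ∀ x → a x → act γ x ≡ x

IsLarge : {G X : Set} → (G → X → X) → Pred (Pred X 0ℓ) 0ℓ → Pred X 0ℓ → Pred X 0ℓ → Set₁
IsLarge {G} act I a b = ∀ c → c ∈ I → ∃[ γ ] (pstab act a γ × c ⊆ image act γ b)

CofinalOrbits : {G X : Set} → (G → X → X) → Pred (Pred X 0ℓ) 0ℓ → Set₁
CofinalOrbits {G} {X} act I = ∀ a → a ∈ I → ∃[ b ] (b ∈ I × IsLarge act I a b)

-- Moves of Player I are elements of I (a subset together with a proof of membership).
Elem : {X : Set} → Pred (Pred X 0ℓ) 0ℓ → Set₁
Elem {X} I = Σ (Pred X 0ℓ) I

-- A strategy for Player II: at round n, from Player I's moves a_0..a_n
-- (Player II's own earlier moves are determined by the strategy) produce γ_n.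
StrategyII : (Γ : Group 0ℓ 0ℓ) {X : Set} → Pred (Pred X 0ℓ) 0ℓ → Set₁
StrategyII Γ I = (n : ℕ) → (Fin (Data.Nat.suc n) → Elem I) → Group.Carrier Γ

module _ (Γ : Group 0ℓ 0ℓ) {X : Set} (act : Group.Carrier Γ → X → X)
         (I : Pred (Pred X 0ℓ) 0ℓ) (σ : StrategyII Γ I) (a : ℕ → Elem I) where
  open Group Γ

  γs : ℕ → Carrier
  γs n = σ n (λ i → a (toℕ i))

  move : ℕ → Pred X 0ℓ
  move n = image act (γs n) (Data.Product.proj₁ (a n))

  unionBelow : ℕ → Pred X 0ℓ
  unionBelow n y = ∃[ m ] (m < n × move m y)

  unionAll : Pred X 0ℓ
  unionAll y = ∃[ n ] move n y

  WonPlay : Set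
  WonPlay = (γs 0 ≈ ε) × (∀ n → pstab act (unionBelow n) (γs n)) × (unionAll ∈ I)

WinningStrategyII : (Γ : Group 0ℓ 0ℓ) {X : Set} (act : Group.Carrier Γ → X → X)
                    (I : Pred (Pred X 0ℓ) 0ℓ) → StrategyII Γ I → Set₁
WinningStrategyII Γ act I σ = ∀ (a : ℕ → Elem I) → WonPlay Γ act I σ a

HasWinningStrategyII : (Γ : Group 0ℓ 0ℓ) {X : Set} (act : Group.Carrier Γ → X → X)
                       (I : Pred (Pred X 0ℓ) 0ℓ) → Set₁
HasWinningStrategyII Γ act I = Σ (StrategyII Γ I) (WinningStrategyII Γ act I)

{-# OPTIONS --safe #-}
-- Player II keeps, besides the part s of X already played, a set b ∈ I that is
-- s-large.  When Player I plays a, Player II first picks b′ that is (s ∪ a)-large,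
-- then uses the largeness of b to find δ fixing s with a ∪ b′ ⊆ δ · b, and answers
-- δ⁻¹.  This pushes the new move into b and replaces b by δ⁻¹ · b′ ⊆ b, which is
-- again large over the enlarged played part, since translating a largeness pair
-- preserves largeness.  Hence every move after the first lands in the initial b,
-- so the whole play is contained in a₀ ∪ b ∈ I.
module Submission where

open import Defs
open import Level using (0ℓ)
open import Algebra.Bundles using (Group)
open import Relation.Unary using (Pred; _⊆_; _∪_; _∈_)
open import Data.Nat using (ℕ; zero; suc; _≤_; _≤′_; ≤′-refl; ≤′-step; s≤s; z≤n)
open import Data.Nat.Properties using (≤-refl; m≤n⇒m≤1+n; ≤⇒≤′; m⊓n≤n; m≤n⇒m⊓n≡m)
open import Data.Fin using (Fin; toℕ; fromℕ<)
open import Data.Fin.Properties using (toℕ-fromℕ<)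
open import Data.Product using (_,_; proj₁; proj₂)
open import Data.Sum using (inj₁; inj₂; [_,_])
open import Function using (_∘_)
open import Relation.Binary.PropositionalEquality
  using (_≡_; refl; sym; trans; cong; cong₂; subst; module ≡-Reasoning)

module _ {X : Set} where

  ⊆-increasing : (P : ℕ → Pred X 0ℓ) → (∀ n → P n ⊆ P (suc n)) →
                 ∀ {m n} → m ≤ n → P m ⊆ P n
  ⊆-increasing P inc m≤n = go (≤⇒≤′ m≤n)
    where
      go : ∀ {m n} → m ≤′ n → P m ⊆ P n
      go ≤′-refl         = λ x → x
      go (≤′-step m≤′n)  = inc _ ∘ go m≤′n

  ⊆-decreasing : (P : ℕ → Pred X 0ℓ) → (∀ n → P (suc n) ⊆ P n) → ∀ n → P n ⊆ P 0
  ⊆-decreasing P dec zero    = λ x → x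
  ⊆-decreasing P dec (suc n) = ⊆-decreasing P dec n ∘ dec n

module _ {G X : Set} (act : G → X → X) where

  image-mono : ∀ {g} {a b : Pred X 0ℓ} → a ⊆ b → image act g a ⊆ image act g b
  image-mono a⊆b (x , x∈a , eq) = x , a⊆b x∈a , eq

  pstab⇒⊆image : ∀ {g} {s : Pred X 0ℓ} → pstab act s g → s ⊆ image act g s
  pstab⇒⊆image fix {x} x∈s = x , x∈s , fix x x∈s

  pstab-antitone : ∀ {g} {a b : Pred X 0ℓ} → a ⊆ b → pstab act b g → pstab act a g
  pstab-antitone a⊆b fix x x∈a = fix x (a⊆b x∈a)

  IsLarge-antitone : ∀ {I} {a a′ b : Pred X 0ℓ} → a′ ⊆ a → IsLarge act I a b → IsLarge act I a′ b
  IsLarge-antitone a′⊆a large c c∈I with large c c∈I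
  ... | g , fix , cover = g , pstab-antitone a′⊆a fix , cover

module _ {Γ : Group 0ℓ 0ℓ} {X : Set} {act : Group.Carrier Γ → X → X}
         (isAction : IsAction Γ X act) where
  open Group Γ using (_∙_; _⁻¹; inverseˡ; inverseʳ)
  open IsAction isAction
  open ≡-Reasoning

  act-inverseˡ : ∀ g x → act (g ⁻¹) (act g x) ≡ x
  act-inverseˡ g x = trans (sym (act-comp (g ⁻¹) g x)) (trans (act-cong (inverseˡ g) x) (act-id x))

  act-inverseʳ : ∀ g x → act g (act (g ⁻¹) x) ≡ x
  act-inverseʳ g x = trans (sym (act-comp g (g ⁻¹) x)) (trans (act-cong (inverseʳ g) x) (act-id x))

  act-conjugate : ∀ g h x → act (g ∙ (h ∙ g ⁻¹)) x ≡ act g (act h (act (g ⁻¹) x))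
  act-conjugate g h x = trans (act-comp g _ x) (cong (act g) (act-comp h (g ⁻¹) x))

  pstab-⁻¹ : ∀ {g} {s : Pred X 0ℓ} → pstab act s g → pstab act s (g ⁻¹)
  pstab-⁻¹ {g} fix x x∈s = begin
    act (g ⁻¹) x           ≡⟨ cong (act (g ⁻¹)) (sym (fix x x∈s)) ⟩
    act (g ⁻¹) (act g x)   ≡⟨ act-inverseˡ g x ⟩
    x                      ∎

  ⊆image⇒image⁻¹⊆ : ∀ {g} {b c : Pred X 0ℓ} → c ⊆ image act g b → image act (g ⁻¹) c ⊆ b
  ⊆image⇒image⁻¹⊆ {g} {b} cover (y , y∈c , refl) with cover y∈c
  ... | z , z∈b , gz≡y = subst b (trans (sym (act-inverseˡ g z)) (cong (act (g ⁻¹)) gz≡y)) z∈b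

  -- Conjugating the witnesses by g: if c ⊆ h · b then g · c ⊆ (g h g⁻¹) · (g · b).
  IsLarge-image : ∀ {I} → (∀ g {c} → c ∈ I → image act g c ∈ I) →
                  ∀ g {a b : Pred X 0ℓ} → IsLarge act I a b →
                  IsLarge act I (image act g a) (image act g b)
  IsLarge-image invariant g {a} {b} large c c∈I
    with large (image act (g ⁻¹) c) (invariant (g ⁻¹) c∈I)
  ... | h , fix , cover = g ∙ (h ∙ g ⁻¹) , conj-fix , conj-cover
    where
      conj-fix : pstab act (image act g a) (g ∙ (h ∙ g ⁻¹))
      conj-fix _ (x , x∈a , refl) = begin
        act (g ∙ (h ∙ g ⁻¹)) (act g x)        ≡⟨ act-conjugate g h (act g x) ⟩
        act g (act h (act (g ⁻¹) (act g x)))  ≡⟨ cong (act g ∘ act h) (act-inverseˡ g x) ⟩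
        act g (act h x)                       ≡⟨ cong (act g) (fix x x∈a) ⟩
        act g x                               ∎
      conj-cover : c ⊆ image act (g ∙ (h ∙ g ⁻¹)) (image act g b)
      conj-cover {y} y∈c with cover (y , y∈c , refl)
      ... | z , z∈b , hz≡g⁻¹y = act g z , (z , z∈b , refl) , (begin
        act (g ∙ (h ∙ g ⁻¹)) (act g z)        ≡⟨ act-conjugate g h (act g z) ⟩
        act g (act h (act (g ⁻¹) (act g z)))  ≡⟨ cong (act g ∘ act h) (act-inverseˡ g z) ⟩
        act g (act h z)                       ≡⟨ cong (act g) hz≡g⁻¹y ⟩
        act g (act (g ⁻¹) y)                  ≡⟨ act-inverseʳ g y ⟩
        y                                     ∎)

-- Indices beyond n are clamped to n; by run-prefix only the first n + 1 matter.
extend : ∀ {A : Set₁} {n} → (Fin (suc n) → A) → ℕ → A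
extend {n = n} f k = f (fromℕ< (s≤s (m⊓n≤n k n)))

extend-toℕ : ∀ {A : Set₁} (a : ℕ → A) {n k} → k ≤ n → extend {n = n} (a ∘ toℕ) k ≡ a k
extend-toℕ a k≤n = cong a (trans (toℕ-fromℕ< _) (m≤n⇒m⊓n≡m k≤n))

module Strategy (Γ : Group 0ℓ 0ℓ) (X : Set) (act : Group.Carrier Γ → X → X)
    (I : Pred (Pred X 0ℓ) 0ℓ) (D : IsDynamicalIdeal Γ X act I) (cof : CofinalOrbits act I) where
  open Group Γ using (ε; _⁻¹) renaming (Carrier to G)
  open IsDynamicalIdeal D
  open IsIdeal isIdeal

  record Position : Set₁ where
    field
      answer     : G
      played     : Pred X 0ℓ
      played∈I   : played ∈ I
      reserve    : Pred X 0ℓ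
      reserve∈I  : reserve ∈ I
      reserve-large : IsLarge act I played reserve

    envelope : Pred X 0ℓ
    envelope = played ∪ reserve

    envelope∈I : envelope ∈ I
    envelope∈I = union played∈I reserve∈I
  open Position

  start : Elem I → Position
  start (a , a∈I) with cof a a∈I
  ... | b , b∈I , large = record
    { answer = ε ; played = a ; played∈I = a∈I
    ; reserve = b ; reserve∈I = b∈I ; reserve-large = large }

  module Respond (p : Position) (e : Elem I) where
    private
      a = proj₁ e
      a∈I = proj₂ e
      next = cof (played p ∪ a) (union (played∈I p) a∈I)
      b′ = proj₁ next
      b′∈I = proj₁ (proj₂ next)
      pushed = reserve-large p (a ∪ b′) (union a∈I b′∈I)
      δ = proj₁ pushed

    γ : G
    γ = δ ⁻¹

    γ-fixes-played : pstab act (played p) γ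
    γ-fixes-played = pstab-⁻¹ isAction (proj₁ (proj₂ pushed))

    γ-pushes-into-reserve : image act γ (a ∪ b′) ⊆ reserve p
    γ-pushes-into-reserve = ⊆image⇒image⁻¹⊆ isAction (proj₂ (proj₂ pushed))

    played′⊆image : played p ∪ image act γ a ⊆ image act γ (played p ∪ a)
    played′⊆image = [ image-mono act inj₁ ∘ pstab⇒⊆image act γ-fixes-played , image-mono act inj₂ ]

    step : Position
    step = record
      { answer = γ
      ; played = played p ∪ image act γ a
      ; played∈I = union (played∈I p) (invariant γ a∈I)
      ; reserve = image act γ b′
      ; reserve∈I = invariant γ b′∈I
      ; reserve-large = IsLarge-antitone act played′⊆image
          (IsLarge-image isAction invariant γ (proj₂ (proj₂ next)))
      }

    envelope-step : envelope step ⊆ envelope p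
    envelope-step (inj₁ (inj₁ x∈played)) = inj₁ x∈played
    envelope-step (inj₁ (inj₂ x∈γa))     = inj₂ (γ-pushes-into-reserve (image-mono act inj₁ x∈γa))
    envelope-step (inj₂ x∈γb′)           = inj₂ (γ-pushes-into-reserve (image-mono act inj₂ x∈γb′))
  open Respond using (step; envelope-step; γ-fixes-played)

  run : (ℕ → Elem I) → ℕ → Position
  run a zero    = start (a 0)
  run a (suc n) = step (run a n) (a (suc n))

  run-prefix : ∀ a a′ n → (∀ k → k ≤ n → a k ≡ a′ k) → run a n ≡ run a′ n
  run-prefix a a′ zero    agree = cong start (agree 0 z≤n)
  run-prefix a a′ (suc n) agree =
    cong₂ step (run-prefix a a′ n (λ k → agree k ∘ m≤n⇒m≤1+n)) (agree (suc n) ≤-refl)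

  σ : StrategyII Γ I
  σ n f = answer (run (extend f) n)

  module _ (a : ℕ → Elem I) where
    private
      R = run a

    γs≡answer : ∀ n → γs Γ act I σ a n ≡ answer (R n)
    γs≡answer n = cong answer (run-prefix _ a n (λ k → extend-toℕ a))

    move⊆played : ∀ n → move Γ act I σ a n ⊆ played (R n)
    move⊆played n rewrite γs≡answer n = go n
      where
        go : ∀ n → image act (answer (R n)) (proj₁ (a n)) ⊆ played (R n)
        go zero    (y , y∈a , refl) = subst (proj₁ (a 0)) (sym (IsAction.act-id isAction y)) y∈a
        go (suc n) y∈move           = inj₂ y∈move

    played-increasing : ∀ {m n} → m ≤ n → played (R m) ⊆ played (R n)
    played-increasing = ⊆-increasing (played ∘ R) (λ _ → inj₁)

    envelope-decreasing : ∀ n → envelope (R n) ⊆ envelope (R 0)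
    envelope-decreasing = ⊆-decreasing (envelope ∘ R) (λ n → envelope-step (R n) (a (suc n)))

    answers-fix-earlier : ∀ n → pstab act (unionBelow Γ act I σ a n) (γs Γ act I σ a n)
    answers-fix-earlier zero    _ (_ , () , _)
    answers-fix-earlier (suc n) x (m , s≤s m≤n , x∈move) =
      trans (cong (λ g → act g x) (γs≡answer (suc n)))
            (γ-fixes-played (R n) (a (suc n)) x (played-increasing m≤n (move⊆played m x∈move)))

    play⊆envelope : unionAll Γ act I σ a ⊆ envelope (R 0)
    play⊆envelope (n , x∈move) = envelope-decreasing n (inj₁ (move⊆played n x∈move))

    σ-wins : WonPlay Γ act I σ a
    σ-wins = Group.refl Γ , answers-fix-earlier , downward play⊆envelope (envelope∈I (R 0))

theorem3p19 : (Γ : Group 0ℓ 0ℓ) (X : Set) (act : Group.Carrier Γ → X → X)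
    (I : Pred (Pred X 0ℓ) 0ℓ) → IsDynamicalIdeal Γ X act I →
    CofinalOrbits act I → HasWinningStrategyII Γ act I
theorem3p19 Γ X act I D cof = σ , σ-wins
  where open Strategy Γ X act I D cof
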